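{- Let $D=(A,B,\lambda)$ be an extremally matched temporal bi-clique with $n:=|A|=|B|$ and let $c\in(0,1]$. If $e$ is a $c$-steep edge of $D$, then $|\mathrm{In}(e)\cap\mathrm{Out}(e)|\ge 2cn$.
   Context: A temporal bi-clique $(A,B,\lambda)$ is the complete bipartite graph with disjoint parts $A,B$ with an edge labeling $\lambda$ into $\mathbb{N}$; assume the labels of the edges incident to any one vertex are pairwise distinct. A path $v_1\dots v_k$ is temporal if $\lambda(\{v_i,v_{i+1}\})\le\lambda(\{v_{i+1},v_{i+2}\})$ for all $i\in[k-2]$. $\pi^-(v)$ ($\pi^+(v)$) is the neighbor joined to $v$ by the edge of minimum (maximum) label; $D$ is extremally matched if both $\{\{v,\pi^-(v)\}\}$ and $\{\{v,\pi^+(v)\}\}$ are perfect matchings. For a vertex $v$ and incident edge $e$, $\mathrm{idx}_v(e)\in[n]$ is the position of $e$ when the edges incident to $v$ are sorted by increasing label. An edge $e=\{v,w\}$ is $c$-steep if $|\mathrm{idx}_v(e)-\mathrm{idx}_w(e)|\ge cn$. For a vertex $v$ and $t\in\mathbb{N}$, $\mathrm{In}_v(t)$ is the set of vertices reaching $v$ by a temporal path with all labels at most $t$, $\mathrm{Out}_v(t)$ the set of vertices $v$ reaches by a temporal path with all labels at least $t$ (both contain $v$); for $e=\{u,v\}$, $\mathrm{In}(e)=\mathrm{In}_u(\lambda(e))\cup\mathrm{In}_v(\lambda(e))$ and $\mathrm{Out}(e)=\mathrm{Out}_u(\lambda(e))\cup\mathrm{Out}_v(\lambda(e))$. -}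

module Defs where

open import Data.Nat using (ℕ; zero; suc; _+_; _*_; _≤_; _<_; _≥_; ∣_-_∣)
open import Data.Nat.Properties using (_<?_)
open import Data.Fin using (Fin)
open import Data.List using (List; []; _∷_; length; filter; head; last)
open import Data.List.Relation.Unary.All using (All)
open import Data.List.Relation.Unary.Linked using (Linked)
open import Data.List.Relation.Unary.Unique.Propositional using (Unique)
open import Data.Maybe using (Maybe; just)
open import Data.Sum using (_⊎_; inj₁; inj₂)
open import Data.Product using (Σ; _×_; ∃; ∃!)
open import Data.List using (allFin) public
open import Relation.Binary.PropositionalEquality using (_≡_; _≢_)

-- A temporal bi-clique with parts A = Fin n and B = Fin n:
-- the label of the edge {a , b} (a ∈ A, b ∈ B) is lab a b.
Labeling : ℕ → Set
Labeling n = Fin n → Fin n → ℕ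

LocallyDistinct : ∀ {n} → Labeling n → Set
LocallyDistinct {n} lab =
  (∀ (a : Fin n) (b b' : Fin n) → lab a b ≡ lab a b' → b ≡ b') ×
  (∀ (b : Fin n) (a a' : Fin n) → lab a b ≡ lab a' b → a ≡ a')

-- vertices: inj₁ a for a ∈ A, inj₂ b for b ∈ B
Vertex : ℕ → Set
Vertex n = Fin n ⊎ Fin n

data Adj {n : ℕ} : Vertex n → Vertex n → Set where
  ab : (a b : Fin n) → Adj (inj₁ a) (inj₂ b)
  ba : (b a : Fin n) → Adj (inj₂ b) (inj₁ a)

-- label of the edge between two vertices (junk value 0 for non-adjacent pairs,
-- which never matters since paths are required to use edges only)
elab : ∀ {n} → Labeling n → Vertex n → Vertex n → ℕ
elab lab (inj₁ a) (inj₂ b) = lab a b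
elab lab (inj₂ b) (inj₁ a) = lab a b
elab lab _ _ = 0

labels : ∀ {n} → Labeling n → List (Vertex n) → List ℕ
labels lab [] = []
labels lab (v ∷ []) = []
labels lab (v ∷ w ∷ vs) = elab lab v w ∷ labels lab (w ∷ vs)

TemporalPath : ∀ {n} → Labeling n → List (Vertex n) → Set
TemporalPath lab vs = Unique vs × Linked Adj vs × Linked _≤_ (labels lab vs)

ReachLe : ∀ {n} → Labeling n → ℕ → Vertex n → Vertex n → Set
ReachLe {n} lab t u v = Σ (List (Vertex n)) λ vs →
  head vs ≡ just u × last vs ≡ just v × TemporalPath lab vs ×
  All (λ l → l ≤ t) (labels lab vs)

ReachGe : ∀ {n} → Labeling n → ℕ → Vertex n → Vertex n → Set
ReachGe {n} lab t u v = Σ (List (Vertex n)) λ vs →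
  head vs ≡ just u × last vs ≡ just v × TemporalPath lab vs ×
  All (λ l → t ≤ l) (labels lab vs)

In_at : ∀ {n} → Labeling n → Vertex n → ℕ → Vertex n → Set
In_at lab v t u = ReachLe lab t u v

Out_at : ∀ {n} → Labeling n → Vertex n → ℕ → Vertex n → Set
Out_at lab v t w = ReachGe lab t v w

InE : ∀ {n} → Labeling n → Fin n → Fin n → Vertex n → Set
InE lab a b u = In_at lab (inj₁ a) (lab a b) u ⊎ In_at lab (inj₂ b) (lab a b) u

OutE : ∀ {n} → Labeling n → Fin n → Fin n → Vertex n → Set
OutE lab a b u = Out_at lab (inj₁ a) (lab a b) u ⊎ Out_at lab (inj₂ b) (lab a b) u

MinNbrA MaxNbrA : ∀ {n} → Labeling n → Fin n → Fin n → Set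
MinNbrA {n} lab a b = ∀ (b' : Fin n) → lab a b ≤ lab a b'
MaxNbrA {n} lab a b = ∀ (b' : Fin n) → lab a b' ≤ lab a b

MinNbrB MaxNbrB : ∀ {n} → Labeling n → Fin n → Fin n → Set
MinNbrB {n} lab b a = ∀ (a' : Fin n) → lab a b ≤ lab a' b
MaxNbrB {n} lab b a = ∀ (a' : Fin n) → lab a' b ≤ lab a b

PerfectMatching : ∀ {n} → (Fin n → Fin n → Set) → Set
PerfectMatching {n} M =
  (∀ (a : Fin n) → ∃! _≡_ (λ b → M a b)) × (∀ (b : Fin n) → ∃! _≡_ (λ a → M a b))

MinEdges MaxEdges : ∀ {n} → Labeling n → Fin n → Fin n → Set
MinEdges lab a b = MinNbrA lab a b ⊎ MinNbrB lab b a
MaxEdges lab a b = MaxNbrA lab a b ⊎ MaxNbrB lab b a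

ExtremallyMatched : ∀ {n} → Labeling n → Set
ExtremallyMatched lab = PerfectMatching (MinEdges lab) × PerfectMatching (MaxEdges lab)

idxA : ∀ {n} → Labeling n → Fin n → Fin n → ℕ
idxA {n} lab a b = suc (length (filter (λ b' → lab a b' <? lab a b) (allFin n)))

idxB : ∀ {n} → Labeling n → Fin n → Fin n → ℕ
idxB {n} lab a b = suc (length (filter (λ a' → lab a' b <? lab a b) (allFin n)))

-- edge {a , b} is c-steep for c = p / q :  |idx_a(e) - idx_b(e)| ≥ (p/q) n
Steep : ∀ {n} → Labeling n → (p q : ℕ) → Fin n → Fin n → Set
Steep {n} lab p q a b = p * n ≤ ∣ idxA lab a b - idxB lab a b ∣ * q

-- Let t = λ(e) for e = {a , b}, and let α (resp. β) count the edges at a (resp. b) with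
-- label below t, so that idx_a(e) = 1 + α, idx_b(e) = 1 + β and steepness reads
-- ∣α − β∣ ≥ cn.  Extremal matching makes π⁺ and π⁻ injective, with π±(π±(v)) = v.
-- If y ∈ B has λ(a y) < t ≤ λ(π⁺(y) b), then y → a and b → π⁺(y) → y are temporal
-- paths, so y ∈ In(e) ∩ Out(e); of the α vertices y with λ(a y) < t, at most β are
-- mapped by π⁺ to some x with λ(x b) < t, so at least α − β such y exist.  The same
-- count through π⁻ yields α − β vertices of A (those x with λ(x b) ≥ t and
-- λ(a π⁻(x)) < t), and the mirrored families give β − α on each side, for a total of
-- 2∣α − β∣ ≥ 2cn.
module Submission where

open import Defs
open import Data.Nat using (ℕ; suc; _+_; _*_; _∸_; _≤_; _<_; _<?_; z≤n; s≤s; ∣_-_∣)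
open import Data.Nat.Properties
  using (≤-refl; ≤-trans; ≤-reflexive; <⇒≤; ≮⇒≥; +-comm; +-suc; +-identityʳ; +-mono-≤; *-assoc;
         *-monoˡ-≤; *-distribʳ-+; ∸-+-assoc; m∸n+n≡m; m+n∸m≡n; [m+n]∸[m+o]≡n∸o;
         m≤n+o⇒m∸n≤o; ∣m-n∣≡[m∸n]∨[n∸m]; module ≤-Reasoning)
open import Data.Fin using (Fin) renaming (_≟_ to _≟ᶠ_)
open import Data.List using (List; []; _∷_; length; filter; map; _++_)
open import Data.List.Properties using (length-filter; length-tabulate; length-removeAt′; length-map; length-++)
open import Data.List.Extrema.Nat using (argmax; argmin; f[xs]≤f[argmax]; f[argmin]≤f[xs])
open import Data.List.Relation.Unary.All as All using (All; []; _∷_)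
import Data.List.Relation.Unary.All.Properties as All
open import Data.List.Relation.Unary.AllPairs using ([]; _∷_)
open import Data.List.Relation.Unary.Any using (here; there; index; _─_)
open import Data.List.Relation.Unary.Linked using ([]; [-]; _∷_)
open import Data.List.Relation.Unary.Unique.Propositional using (Unique)
import Data.List.Relation.Unary.Unique.Propositional.Properties as Unique
open import Data.List.Relation.Binary.Subset.Propositional using (_⊆_)
open import Data.List.Relation.Binary.Disjoint.Propositional using (Disjoint)
open import Data.List.Membership.Propositional using (_∈_)
open import Data.List.Membership.Propositional.Properties using (∈-allFin; ∈-filter⁺; ∈-filter⁻; ∈-map⁻)
open import Data.Product using (Σ; _×_; _,_; proj₁; proj₂; ∃)
open import Data.Sum using (_⊎_; inj₁; inj₂)
open import Data.Sum.Properties using (≡-dec; inj₁-injective; inj₂-injective)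
open import Function using (_∘_; Injective)
open import Level using (Level)
open import Relation.Nullary using (Dec; yes; no; contradiction)
open import Relation.Nullary.Decidable using (decidable-stable)
open import Relation.Unary using (Pred; Decidable)
open import Relation.Unary.Properties using (∁?)
open import Relation.Binary.PropositionalEquality

private
  variable
    ℓ ℓ′ : Level
    A : Set ℓ

∈-─⁺ : ∀ {x y} {ys : List A} (x∈ys : x ∈ ys) → y ∈ ys → y ≢ x → y ∈ (ys ─ x∈ys)
∈-─⁺ (here refl) (here refl) y≢x = contradiction refl y≢x
∈-─⁺ (here _) (there y∈) _ = y∈
∈-─⁺ (there _) (here refl) _ = here refl
∈-─⁺ (there x∈) (there y∈) y≢x = there (∈-─⁺ x∈ y∈ y≢x)

Unique-⊆⇒length-≤ : ∀ {xs ys : List A} → Unique xs → xs ⊆ ys → length xs ≤ length ys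
Unique-⊆⇒length-≤ {xs = []} _ _ = z≤n
Unique-⊆⇒length-≤ {xs = x ∷ xs} {ys} (x∉xs ∷ xs!) xs⊆ys = begin
  suc (length xs)                  ≤⟨ s≤s (Unique-⊆⇒length-≤ xs! xs⊆ys─x) ⟩
  suc (length (ys ─ x∈ys))         ≡⟨ length-removeAt′ ys (index x∈ys) ⟨
  length ys                        ∎
  where
  open ≤-Reasoning
  x∈ys : x ∈ ys
  x∈ys = xs⊆ys (here refl)
  xs⊆ys─x : xs ⊆ (ys ─ x∈ys)
  xs⊆ys─x y∈xs = ∈-─⁺ x∈ys (xs⊆ys (there y∈xs)) (λ y≡x → All.lookup x∉xs y∈xs (sym y≡x))

module _ {P : Pred A ℓ} (P? : Decidable P) where

  length-filter-∁ : ∀ xs → length (filter P? xs) + length (filter (∁? P?) xs) ≡ length xs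
  length-filter-∁ [] = refl
  length-filter-∁ (x ∷ xs) with P? x
  ... | yes _ = cong suc (length-filter-∁ xs)
  ... | no _  = trans (+-suc _ _) (cong suc (length-filter-∁ xs))

count : ∀ {m} {P : Pred (Fin m) ℓ} → Decidable P → ℕ
count {m = m} P? = length (filter P? (allFin m))

module _ {m} {P : Pred (Fin m) ℓ} (P? : Decidable P) where

  count≤m : count P? ≤ m
  count≤m = ≤-trans (length-filter P? (allFin m)) (≤-reflexive (length-tabulate (λ i → i)))

  count-∁ : count (∁? P?) ≡ m ∸ count P?
  count-∁ = begin
    count (∁? P?)                              ≡⟨ m+n∸m≡n (count P?) _ ⟨
    count P? + count (∁? P?) ∸ count P?        ≡⟨ cong (_∸ count P?) (length-filter-∁ P? (allFin m)) ⟩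
    length (allFin m) ∸ count P?               ≡⟨ cong (_∸ count P?) (length-tabulate (λ i → i)) ⟩
    m ∸ count P?                               ∎
    where open ≡-Reasoning

[m∸n]∸[m∸o]≡o∸n : ∀ m n {o} → o ≤ m → (m ∸ n) ∸ (m ∸ o) ≡ o ∸ n
[m∸n]∸[m∸o]≡o∸n m n {o} o≤m = begin
  (m ∸ n) ∸ (m ∸ o)                  ≡⟨ ∸-+-assoc m n (m ∸ o) ⟩
  m ∸ (n + (m ∸ o))                  ≡⟨ cong₂ _∸_ (m∸n+n≡m o≤m) (+-comm (m ∸ o) n) ⟨
  ((m ∸ o) + o) ∸ ((m ∸ o) + n)      ≡⟨ [m+n]∸[m+o]≡n∸o (m ∸ o) o n ⟩
  o ∸ n                              ∎
  where open ≡-Reasoning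

∣∁P∣∸∣∁Q∣≡∣Q∣∸∣P∣ : ∀ {m} {P : Pred (Fin m) ℓ} {Q : Pred (Fin m) ℓ′} (P? : Decidable P) (Q? : Decidable Q) →
                    count (∁? P?) ∸ count (∁? Q?) ≡ count Q? ∸ count P?
∣∁P∣∸∣∁Q∣≡∣Q∣∸∣P∣ {m = m} P? Q? =
  trans (cong₂ _∸_ (count-∁ P?) (count-∁ Q?)) ([m∸n]∸[m∸o]≡o∸n m (count P?) (count≤m Q?))

∣P∣∸∣Q∣≤∣P∩∁f⁻¹Q∣ : ∀ {m k} {P : Pred (Fin m) ℓ} {Q : Pred (Fin k) ℓ′} (P? : Decidable P) (Q? : Decidable Q)
                    {f : Fin m → Fin k} → Injective _≡_ _≡_ f →
                    count P? ∸ count Q? ≤ length (filter (∁? (Q? ∘ f)) (filter P? (allFin m)))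
∣P∣∸∣Q∣≤∣P∩∁f⁻¹Q∣ {m = m} P? Q? {f} f-inj = m≤n+o⇒m∸n≤o (count P?) (count Q?) (begin
  count P?                             ≡⟨ length-filter-∁ (Q? ∘ f) xs ⟨
  length (filter (Q? ∘ f) xs) + _      ≤⟨ +-mono-≤ sent-into-Q ≤-refl ⟩
  count Q? + _                         ∎)
  where
  open ≤-Reasoning
  xs : List (Fin m)
  xs = filter P? (allFin m)
  image-Unique : Unique (map f (filter (Q? ∘ f) xs))
  image-Unique = Unique.map⁺ f-inj (Unique.filter⁺ (Q? ∘ f) (Unique.filter⁺ P? (Unique.allFin⁺ m)))
  image⊆Q : map f (filter (Q? ∘ f) xs) ⊆ filter Q? (allFin _)
  image⊆Q y∈ with ∈-map⁻ f y∈
  ... | x , x∈ , refl = ∈-filter⁺ Q? (∈-allFin (f x)) (proj₂ (∈-filter⁻ (Q? ∘ f) {xs = xs} x∈))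
  sent-into-Q : length (filter (Q? ∘ f) xs) ≤ count Q?
  sent-into-Q = begin
    length (filter (Q? ∘ f) xs)          ≡⟨ length-map f (filter (Q? ∘ f) xs) ⟨
    length (map f (filter (Q? ∘ f) xs))  ≤⟨ Unique-⊆⇒length-≤ image-Unique image⊆Q ⟩
    count Q?                             ∎

∣Q∣∸∣P∣≤∣∁P∩∁f⁻¹∁Q∣ : ∀ {m} {P : Pred (Fin m) ℓ} {Q : Pred (Fin m) ℓ′} (P? : Decidable P) (Q? : Decidable Q)
                      {f : Fin m → Fin m} → Injective _≡_ _≡_ f →
                      count Q? ∸ count P? ≤ length (filter (∁? (∁? Q? ∘ f)) (filter (∁? P?) (allFin m)))
∣Q∣∸∣P∣≤∣∁P∩∁f⁻¹∁Q∣ P? Q? f-inj =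
  ≤-trans (≤-reflexive (sym (∣∁P∣∸∣∁Q∣≡∣Q∣∸∣P∣ P? Q?))) (∣P∣∸∣Q∣≤∣P∩∁f⁻¹Q∣ (∁? P?) (∁? Q?) f-inj)

argmaxᶠ : ∀ {m} → Fin m → (f : Fin m → ℕ) → ∃ λ i → ∀ j → f j ≤ f i
argmaxᶠ {m = m} i₀ f = argmax f i₀ (allFin m) , λ j → All.lookup (f[xs]≤f[argmax] i₀ (allFin m)) (∈-allFin j)

argminᶠ : ∀ {m} → Fin m → (f : Fin m → ℕ) → ∃ λ i → ∀ j → f i ≤ f j
argminᶠ {m = m} i₀ f = argmin f i₀ (allFin m) , λ j → All.lookup (f[argmin]≤f[xs] i₀ (allFin m)) (∈-allFin j)

-- R x y : y is the extremal neighbour of x ∈ A;  S y x : x is the extremal neighbour of y ∈ B.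
module ExtremalPartners {n} {R S : Fin n → Fin n → Set}
  (matched : PerfectMatching (λ x y → R x y ⊎ S y x))
  (R-exists : ∀ x → ∃ (R x)) (S-exists : ∀ y → ∃ (S y)) where

  private
    matched-at-A : ∀ {x y y′} → R x y ⊎ S y x → R x y′ ⊎ S y′ x → y ≡ y′
    matched-at-A {x} e e′ with proj₁ matched x
    ... | _ , _ , unique = trans (sym (unique e)) (unique e′)

    matched-at-B : ∀ {x x′ y} → R x y ⊎ S y x → R x′ y ⊎ S y x′ → x ≡ x′
    matched-at-B {y = y} e e′ with proj₂ matched y
    ... | _ , _ , unique = trans (sym (unique e)) (unique e′)

  toA : Fin n → Fin n
  toA y = proj₁ (S-exists y)

  R-toA : ∀ y → R (toA y) y
  R-toA y with R-exists (toA y)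
  ... | y′ , r = subst (R (toA y)) (matched-at-A (inj₁ r) (inj₂ (proj₂ (S-exists y)))) r

  toA-injective : Injective _≡_ _≡_ toA
  toA-injective {y} {y′} eq = matched-at-A (inj₁ (R-toA y)) (inj₁ (subst (λ x → R x y′) (sym eq) (R-toA y′)))

  toB : Fin n → Fin n
  toB x = proj₁ (R-exists x)

  S-toB : ∀ x → S (toB x) x
  S-toB x with S-exists (toB x)
  ... | x′ , s = subst (S (toB x)) (matched-at-B (inj₂ s) (inj₁ (proj₂ (R-exists x)))) s

  toB-injective : Injective _≡_ _≡_ toB
  toB-injective {x} {x′} eq = matched-at-B (inj₂ (S-toB x)) (inj₂ (subst (λ y → S y x′) (sym eq) (S-toB x′)))

module _ {n} (lab : Labeling n) where

  private
    _≟ᵛ_ : (u v : Vertex n) → Dec (u ≡ v)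
    _≟ᵛ_ = ≡-dec _≟ᶠ_ _≟ᶠ_

  Adj⇒≢ : ∀ {u v : Vertex n} → Adj u v → u ≢ v
  Adj⇒≢ (ab _ _) ()
  Adj⇒≢ (ba _ _) ()

  edge-TemporalPath : ∀ {u v} → Adj u v → TemporalPath lab (u ∷ v ∷ [])
  edge-TemporalPath uv = ((Adj⇒≢ uv ∷ []) ∷ [] ∷ []) , uv ∷ [-] , [-]

  two-edge-TemporalPath : ∀ {u v w} → Adj u v → Adj v w → u ≢ w →
                          elab lab u v ≤ elab lab v w → TemporalPath lab (u ∷ v ∷ w ∷ [])
  two-edge-TemporalPath uv vw u≢w uv≤vw =
    ((Adj⇒≢ uv ∷ u≢w ∷ []) ∷ (Adj⇒≢ vw ∷ []) ∷ [] ∷ []) , uv ∷ vw ∷ [-] , uv≤vw ∷ [-]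

  trivial-TemporalPath : ∀ v → TemporalPath lab (v ∷ [])
  trivial-TemporalPath v = [] ∷ [] , [-] , []

  ReachLe-edge : ∀ {t u v} → Adj u v → elab lab u v ≤ t → ReachLe lab t u v
  ReachLe-edge uv ≤t = _ , refl , refl , edge-TemporalPath uv , ≤t ∷ []

  ReachGe-edge : ∀ {t u v} → Adj u v → t ≤ elab lab u v → ReachGe lab t u v
  ReachGe-edge uv t≤ = _ , refl , refl , edge-TemporalPath uv , t≤ ∷ []

  ReachLe-two-edges : ∀ {t u v w} → Adj u v → Adj v w →
                      elab lab u v ≤ elab lab v w → elab lab v w ≤ t → ReachLe lab t u w
  ReachLe-two-edges {u = u} {w = w} uv vw uv≤vw ≤t with u ≟ᵛ w
  ... | yes refl = _ , refl , refl , trivial-TemporalPath u , []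
  ... | no u≢w   = _ , refl , refl , two-edge-TemporalPath uv vw u≢w uv≤vw , ≤-trans uv≤vw ≤t ∷ ≤t ∷ []

  ReachGe-two-edges : ∀ {t u v w} → Adj u v → Adj v w →
                      elab lab u v ≤ elab lab v w → t ≤ elab lab u v → ReachGe lab t u w
  ReachGe-two-edges {u = u} {w = w} uv vw uv≤vw t≤ with u ≟ᵛ w
  ... | yes refl = _ , refl , refl , trivial-TemporalPath u , []
  ... | no u≢w   = _ , refl , refl , two-edge-TemporalPath uv vw u≢w uv≤vw , t≤ ∷ ≤-trans t≤ uv≤vw ∷ []

Disjoint-inj₁-inj₂ : ∀ {B : Set ℓ′} (xs : List A) (ys : List B) → Disjoint (map inj₁ xs) (map inj₂ ys)
Disjoint-inj₁-inj₂ xs ys (v∈₁ , v∈₂) with ∈-map⁻ inj₁ v∈₁ | ∈-map⁻ inj₂ v∈₂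
... | _ , _ , refl | _ , _ , ()

module EdgeNeighbourhood {n} (lab : Labeling n) (em : ExtremallyMatched lab) (a b : Fin n) where

  private
    t : ℕ
    t = lab a b
    -- Max.toA y = π⁺(y) and Max.toB x = π⁺(x); likewise Min for π⁻.
    module Max = ExtremalPartners {R = MaxNbrA lab} {S = MaxNbrB lab} (proj₂ em)
                   (λ x → argmaxᶠ x (lab x)) (λ y → argmaxᶠ y (λ x → lab x y))
    module Min = ExtremalPartners {R = MinNbrA lab} {S = MinNbrB lab} (proj₁ em)
                   (λ x → argminᶠ x (lab x)) (λ y → argminᶠ y (λ x → lab x y))

  InOut : Vertex n → Set
  InOut v = InE lab a b v × OutE lab a b v

  InOut-via-π⁺ᴮ : ∀ y → lab a y ≤ t → t ≤ lab (Max.toA y) b → InOut (inj₂ y)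
  InOut-via-π⁺ᴮ y ay≤t t≤xb =
    inj₁ (ReachLe-edge lab (ba y a) ay≤t) ,
    inj₂ (ReachGe-two-edges lab (ba b _) (ab _ y) (Max.R-toA y b) t≤xb)

  InOut-via-π⁻ᴬ : ∀ x → t ≤ lab x b → lab a (Min.toB x) ≤ t → InOut (inj₁ x)
  InOut-via-π⁻ᴬ x t≤xb ay≤t =
    inj₁ (ReachLe-two-edges lab (ab x _) (ba _ a) (Min.S-toB x a) ay≤t) ,
    inj₂ (ReachGe-edge lab (ba b x) t≤xb)

  InOut-via-π⁺ᴬ : ∀ x → lab x b ≤ t → t ≤ lab a (Max.toB x) → InOut (inj₁ x)
  InOut-via-π⁺ᴬ x xb≤t t≤ay =
    inj₂ (ReachLe-edge lab (ab x b) xb≤t) ,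
    inj₁ (ReachGe-two-edges lab (ab a _) (ba _ x) (Max.S-toB x a) t≤ay)

  InOut-via-π⁻ᴮ : ∀ y → t ≤ lab a y → lab (Min.toA y) b ≤ t → InOut (inj₂ y)
  InOut-via-π⁻ᴮ y t≤ay xb≤t =
    inj₂ (ReachLe-two-edges lab (ba y _) (ab _ b) (Min.R-toA y b) xb≤t) ,
    inj₁ (ReachGe-edge lab (ab a y) t≤ay)

  before-a? : Decidable (λ y → lab a y < t)
  before-a? y = lab a y <? t

  before-b? : Decidable (λ x → lab x b < t)
  before-b? x = lab x b <? t

  α β : ℕ
  α = count before-a?
  β = count before-b?

  InOutSet : (Fin n → Vertex n) → ℕ → Set
  InOutSet side d = Σ (List (Fin n)) λ xs → Unique xs × All (InOut ∘ side) xs × d ≤ length xs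

  InOutSet-filter : ∀ {side d} {P R : Pred (Fin n) ℓ} (P? : Decidable P) (R? : Decidable R) →
                    (∀ {x} → P x → R x → InOut (side x)) →
                    d ≤ length (filter R? (filter P? (allFin n))) → InOutSet side d
  InOutSet-filter {side = side} P? R? inOut d≤ =
    _ , Unique.filter⁺ R? (Unique.filter⁺ P? (Unique.allFin⁺ n)) , All.tabulate members-InOut , d≤
    where
    members-InOut : ∀ {x} → x ∈ filter R? (filter P? (allFin n)) → InOut (side x)
    members-InOut x∈ with ∈-filter⁻ R? {xs = filter P? (allFin n)} x∈
    ... | x∈P , r = inOut (proj₂ (∈-filter⁻ P? {xs = allFin n} x∈P)) r

  B-via-π⁺ : InOutSet inj₂ (α ∸ β)
  B-via-π⁺ = InOutSet-filter before-a? (∁? (before-b? ∘ Max.toA))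
    (λ ay<t xb≮t → InOut-via-π⁺ᴮ _ (<⇒≤ ay<t) (≮⇒≥ xb≮t))
    (∣P∣∸∣Q∣≤∣P∩∁f⁻¹Q∣ before-a? before-b? Max.toA-injective)

  A-via-π⁺ : InOutSet inj₁ (β ∸ α)
  A-via-π⁺ = InOutSet-filter before-b? (∁? (before-a? ∘ Max.toB))
    (λ xb<t ay≮t → InOut-via-π⁺ᴬ _ (<⇒≤ xb<t) (≮⇒≥ ay≮t))
    (∣P∣∸∣Q∣≤∣P∩∁f⁻¹Q∣ before-b? before-a? Max.toB-injective)

  A-via-π⁻ : InOutSet inj₁ (α ∸ β)
  A-via-π⁻ = InOutSet-filter (∁? before-b?) (∁? (∁? before-a? ∘ Min.toB))
    (λ xb≮t ¬ay≮t → InOut-via-π⁻ᴬ _ (≮⇒≥ xb≮t) (<⇒≤ (decidable-stable (before-a? _) ¬ay≮t)))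
    (∣Q∣∸∣P∣≤∣∁P∩∁f⁻¹∁Q∣ before-b? before-a? Min.toB-injective)

  B-via-π⁻ : InOutSet inj₂ (β ∸ α)
  B-via-π⁻ = InOutSet-filter (∁? before-a?) (∁? (∁? before-b? ∘ Min.toA))
    (λ ay≮t ¬xb≮t → InOut-via-π⁻ᴮ _ (≮⇒≥ ay≮t) (<⇒≤ (decidable-stable (before-b? _) ¬xb≮t)))
    (∣Q∣∸∣P∣≤∣∁P∩∁f⁻¹∁Q∣ before-a? before-b? Min.toA-injective)

  InOutSets : InOutSet inj₁ ∣ α - β ∣ × InOutSet inj₂ ∣ α - β ∣
  InOutSets with ∣m-n∣≡[m∸n]∨[n∸m] α β
  ... | inj₁ eq rewrite eq = A-via-π⁻ , B-via-π⁺
  ... | inj₂ eq rewrite eq = A-via-π⁺ , B-via-π⁻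

  InOut-list : Σ (List (Vertex n)) λ L → Unique L × All InOut L × ∣ α - β ∣ + ∣ α - β ∣ ≤ length L
  InOut-list with InOutSets
  ... | (xs , xs! , xs-InOut , d≤∣xs∣) , (ys , ys! , ys-InOut , d≤∣ys∣) =
    map inj₁ xs ++ map inj₂ ys ,
    Unique.++⁺ (Unique.map⁺ inj₁-injective xs!) (Unique.map⁺ inj₂-injective ys!) (Disjoint-inj₁-inj₂ xs ys) ,
    All.++⁺ (All.map⁺ xs-InOut) (All.map⁺ ys-InOut) ,
    ≤-trans (+-mono-≤ d≤∣xs∣ d≤∣ys∣) (≤-reflexive (sym length-union))
    where
    length-union : length (map inj₁ xs ++ map inj₂ ys) ≡ length xs + length ys
    length-union = trans (length-++ (map inj₁ xs)) (cong₂ _+_ (length-map inj₁ xs) (length-map inj₂ ys))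

pn≤dq⇒2pn≤lq : ∀ {p q n d l} → p * n ≤ d * q → d + d ≤ l → 2 * p * n ≤ l * q
pn≤dq⇒2pn≤lq {p} {q} {n} {d} {l} pn≤dq d+d≤l = begin
  2 * p * n          ≡⟨ *-assoc 2 p n ⟩
  p * n + (p * n + 0) ≡⟨ cong (p * n +_) (+-identityʳ (p * n)) ⟩
  p * n + p * n      ≤⟨ +-mono-≤ pn≤dq pn≤dq ⟩
  d * q + d * q      ≡⟨ *-distribʳ-+ q d d ⟨
  (d + d) * q        ≤⟨ *-monoˡ-≤ q d+d≤l ⟩
  l * q              ∎
  where open ≤-Reasoning

lemma26 : (n : ℕ) (lab : Labeling n) → LocallyDistinct lab → ExtremallyMatched lab →
    (p q : ℕ) → 0 < p → p ≤ q →
    (a b : Fin n) → Steep lab p q a b →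
    Σ (List (Vertex n)) λ L → Unique L ×
      All (λ v → InE lab a b v × OutE lab a b v) L ×
      2 * p * n ≤ length L * q
lemma26 n lab _ em p q _ _ a b steep =
  let open EdgeNeighbourhood lab em a b
      (L , L! , L-InOut , 2d≤∣L∣) = InOut-list
  in  L , L! , L-InOut , pn≤dq⇒2pn≤lq {p} {q} {n} {∣ α - β ∣} steep 2d≤∣L∣
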